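{- Let $p$ be a prime and let $h\ge 1$, $r\ge 2$ be integers. Two $(\mathbf z,A)$-elation groups $E,\bar E$ of ${\rm PG}(r-1,p^h)$ are conjugate in ${\rm PGL}(r,p^h)$ if and only if they are equivalent, i.e. if and only if $H_{\bar E}=\alpha H_E$ for some $\alpha\in{\rm GF}(p^h)\setminus\{0\}$.
   Context: In ${\rm PG}(r-1,p^h)$ use homogeneous coordinates $(X_0,\ldots,X_{r-1})$, let $\mathbf z=(0,\ldots,0,1)$ and let $A$ be the hyperplane $X_0=0$. For $\lambda\in{\rm GF}(p^h)$ let $e_\lambda$ be the collineation induced by the $r\times r$ matrix $\mathbf M_\lambda$ equal to the identity matrix except that its entry in row $r$, column $1$ is $\lambda$ (so $e_\lambda$ maps $(x_0,\ldots,x_{r-1})$ to $(x_0,\ldots,x_{r-2},x_{r-1}+\lambda x_0)$); these are exactly the elations with center $\mathbf z$ and axis $A$. A $(\mathbf z,A)$-elation group is a group $E=\{e_\lambda:\lambda\in H_E\}$ where $H_E$ is an additive subgroup of ${\rm GF}(p^h)$ (note $e_\lambda e_{\lambda'}=e_{\lambda+\lambda'}$). Two $(\mathbf z,A)$-elation groups $E,\bar E$ are called equivalent if $H_{\bar E}=\alpha H_E$ for some nonzero $\alpha\in{\rm GF}(p^h)$. -}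

module Defs where

open import Data.Nat as ℕ using (ℕ; _^_; _∸_)
open import Data.Fin using (Fin; zero; suc; toℕ)
open import Data.Bool using (if_then_else_; _∧_)
open import Data.Product using (Σ; ∃; _×_; _,_)
open import Relation.Binary.PropositionalEquality using (_≡_)
open import Relation.Nullary using (¬_; does)
open import Algebra.Core using (Op₁; Op₂)
open import Algebra.Structures using (IsCommutativeRing)
open import Function.Bundles using (_⤖_)

-- A finite field of order p^h (any such field is GF(p^h), unique up to
-- isomorphism), with propositional equality on the carrier.
record GF (p h : ℕ) : Set₁ where
  infixl 7 _*_
  infixl 6 _+_
  field
    Carrier : Set
    _+_ _*_ : Op₂ Carrier
    -_ : Op₁ Carrier
    0# 1# : Carrier
    isCommutativeRing : IsCommutativeRing _≡_ _+_ _*_ -_ 0# 1#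
    0≢1 : ¬ (0# ≡ 1#)
    inverse : ∀ x → ¬ (x ≡ 0#) → Σ Carrier (λ y → x * y ≡ 1#)
    card : Fin (p ^ h) ⤖ Carrier

module _ {p h : ℕ} (F : GF p h) where
  open GF F

  Matrix : ℕ → Set
  Matrix r = Fin r → Fin r → Carrier

  ∑ : {n : ℕ} → (Fin n → Carrier) → Carrier
  ∑ {ℕ.zero} f = 0#
  ∑ {ℕ.suc n} f = f zero + ∑ (λ i → f (suc i))

  _⊗_ : {r : ℕ} → Matrix r → Matrix r → Matrix r
  (M ⊗ N) i k = ∑ (λ j → M i j * N j k)

  I : {r : ℕ} → Matrix r
  I i j = if does (toℕ i ℕ.≟ toℕ j) then 1# else 0#

  -- M_λ : identity except entry (row r, column 1) equal to λ
  -- (rows/columns indexed 0..r-1, so that is index (r-1, 0)).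
  elationMatrix : (r : ℕ) → Carrier → Matrix r
  elationMatrix r λ' i j =
    if does (toℕ i ℕ.≟ r ∸ 1) ∧ does (toℕ j ℕ.≟ 0) then λ' else I i j

  -- Two matrices induce the same collineation iff they agree up to a
  -- nonzero scalar.
  _∼_ : {r : ℕ} → Matrix r → Matrix r → Set
  M ∼ N = Σ Carrier (λ c → ¬ (c ≡ 0#) × (∀ i j → M i j ≡ c * N i j))

  -- An additive subgroup H_E of GF(p^h); the (z,A)-elation group is
  -- E = { e_λ : λ ∈ H_E }.
  record ElationGroup : Set₁ where
    field
      H : Carrier → Set
      H-0 : H 0#
      H-+ : ∀ {x y} → H x → H y → H (x + y)
      H-- : ∀ {x} → H x → H (- x)

  open ElationGroup

  Conjugate : (r : ℕ) → ElationGroup → ElationGroup → Set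
  Conjugate r E E' =
    Σ (Matrix r) λ g → Σ (Matrix r) λ g' →
      (∀ i j → (g ⊗ g') i j ≡ I i j) ×
      (∀ i j → (g' ⊗ g) i j ≡ I i j) ×
      (∀ l → H E l → Σ Carrier λ m → H E' m ×
          ((g ⊗ elationMatrix r l) ⊗ g') ∼ elationMatrix r m) ×
      (∀ m → H E' m → Σ Carrier λ l → H E l ×
          ((g ⊗ elationMatrix r l) ⊗ g') ∼ elationMatrix r m)

  Equivalent : ElationGroup → ElationGroup → Set
  Equivalent E E' =
    Σ Carrier λ α → ¬ (α ≡ 0#) ×
      (∀ x → (H E' x → Σ Carrier (λ y → H E y × x ≡ α * y)) ×
             (Σ Carrier (λ y → H E y × x ≡ α * y) → H E' x))

-- Conjugating e_λ by g gives the rank-one update I + λ u vᵀ, where u is the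
-- last column of g and v the first row of g⁻¹. Comparing entries (0,0),
-- (1,1), (0,1) and (r-1,0) shows that such a matrix is a scalar multiple of
-- some M_μ only if the scalar is 1 and μ = αλ with α = g_{r-1,r-1} (g⁻¹)₀₀,
-- independent of λ; so H_Ē = α H_E, unless α = 0, in which case both groups
-- are trivial. Conversely diag(α⁻¹, 1, …, 1) conjugates e_λ to e_{αλ}.
module Submission where

open import Defs
open import Data.Nat as ℕ using (ℕ; _≤_; s≤s; z≤n)
open import Data.Nat.Primality using (Prime)
open import Data.Fin as Fin using (Fin; zero; suc; fromℕ; toℕ)
open import Data.Fin.Properties using (toℕ-fromℕ; toℕ-injective; inj⇒≟)
open import Data.Bool.Properties using (∧-zeroʳ)
open import Data.Bool using (true; if_then_else_; _∧_)
open import Data.Product using (Σ; _×_; _,_; proj₁; proj₂)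
open import Data.Sum using (_⊎_; inj₁; inj₂)
open import Function.Base using (_∘_)
open import Function.Properties.Bijection using (⤖⇒↔)
open import Function.Properties.Inverse using (↔-sym; ↔⇒↣)
open import Algebra.Bundles using (CommutativeRing)
open import Relation.Binary.Definitions using (DecidableEquality)
open import Relation.Binary.PropositionalEquality
open import Relation.Nullary using (¬_; Dec; yes; no; does; contradiction)
open import Relation.Nullary.Decidable using (dec-true; dec-false)

module _ {p h : ℕ} (F : GF p h) where
  open GF F
  open ElationGroup

  private
    commutativeRing : CommutativeRing _ _
    commutativeRing = record { isCommutativeRing = isCommutativeRing }

  open CommutativeRing commutativeRing
    using ( +-identityˡ; +-identityʳ; *-identityˡ; *-identityʳ; *-assoc; *-comm
          ; distribˡ; distribʳ; zeroˡ; zeroʳ; +-group; +-commutativeSemigroup; *-commutativeSemigroup)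
  open import Algebra.Properties.Group +-group using () renaming (∙-cancelˡ to +-cancelˡ)
  open import Algebra.Properties.CommutativeSemigroup +-commutativeSemigroup
    using () renaming (interchange to +-interchange)
  open import Algebra.Properties.CommutativeSemigroup *-commutativeSemigroup
    using (x∙yz≈yx∙z; xy∙z≈y∙xz; xy∙z≈xz∙y; xy∙z≈yz∙x) renaming (interchange to *-interchange)
  open ≡-Reasoning

  _≟_ : DecidableEquality Carrier
  _≟_ = inj⇒≟ (↔⇒↣ (↔-sym (⤖⇒↔ card)))

  1≢0 : ¬ 1# ≡ 0#
  1≢0 = 0≢1 ∘ sym

  x*y≡0⇒x≡0⊎y≡0 : ∀ {x y} → x * y ≡ 0# → x ≡ 0# ⊎ y ≡ 0#
  x*y≡0⇒x≡0⊎y≡0 {x} {y} xy≡0 with x ≟ 0#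
  ... | yes x≡0 = inj₁ x≡0
  ... | no x≢0 with inverse x x≢0
  ...   | x⁻¹ , xx⁻¹≡1 = inj₂ (begin
    y                 ≡⟨ *-identityˡ y ⟨
    1# * y            ≡⟨ cong (_* y) (trans (sym xx⁻¹≡1) (*-comm x x⁻¹)) ⟩
    (x⁻¹ * x) * y     ≡⟨ *-assoc x⁻¹ x y ⟩
    x⁻¹ * (x * y)     ≡⟨ cong (x⁻¹ *_) xy≡0 ⟩
    x⁻¹ * 0#          ≡⟨ zeroʳ x⁻¹ ⟩
    0#                ∎)

  ∑-cong : ∀ {n} {f g : Fin n → Carrier} → (∀ i → f i ≡ g i) → ∑ F f ≡ ∑ F g
  ∑-cong {ℕ.zero}  f≗g = refl
  ∑-cong {ℕ.suc n} f≗g = cong₂ _+_ (f≗g zero) (∑-cong (f≗g ∘ suc))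

  ∑-zero : ∀ {n} {f : Fin n → Carrier} → (∀ i → f i ≡ 0#) → ∑ F f ≡ 0#
  ∑-zero {ℕ.zero}  f≗0 = refl
  ∑-zero {ℕ.suc n} f≗0 = trans (cong₂ _+_ (f≗0 zero) (∑-zero (f≗0 ∘ suc))) (+-identityˡ 0#)

  ∑-distrib-+ : ∀ {n} (f g : Fin n → Carrier) → ∑ F (λ i → f i + g i) ≡ ∑ F f + ∑ F g
  ∑-distrib-+ {ℕ.zero}  f g = sym (+-identityˡ 0#)
  ∑-distrib-+ {ℕ.suc n} f g = begin
    (f zero + g zero) + ∑ F (λ i → f (suc i) + g (suc i))
      ≡⟨ cong (f zero + g zero +_) (∑-distrib-+ (f ∘ suc) (g ∘ suc)) ⟩
    (f zero + g zero) + (∑ F (f ∘ suc) + ∑ F (g ∘ suc))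
      ≡⟨ +-interchange (f zero) (g zero) _ _ ⟩
    (f zero + ∑ F (f ∘ suc)) + (g zero + ∑ F (g ∘ suc)) ∎

  *-distribˡ-∑ : ∀ {n} x (f : Fin n → Carrier) → x * ∑ F f ≡ ∑ F (λ i → x * f i)
  *-distribˡ-∑ {ℕ.zero}  x f = zeroʳ x
  *-distribˡ-∑ {ℕ.suc n} x f = trans (distribˡ x _ _) (cong (x * f zero +_) (*-distribˡ-∑ x (f ∘ suc)))

  I-diag : ∀ {n} (i : Fin n) → I F i i ≡ 1#
  I-diag zero    = refl
  I-diag (suc i) = I-diag i

  I-off : ∀ {n} {i j : Fin n} → ¬ i ≡ j → I F i j ≡ 0#
  I-off {i = zero}  {zero}  i≢j = contradiction refl i≢j
  I-off {i = zero}  {suc j} i≢j = refl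
  I-off {i = suc i} {zero}  i≢j = refl
  I-off {i = suc i} {suc j} i≢j = I-off (i≢j ∘ cong suc)

  ∑-Iˡ : ∀ {n} (k : Fin n) (f : Fin n → Carrier) → ∑ F (λ a → I F k a * f a) ≡ f k
  ∑-Iˡ zero f = trans (cong₂ _+_ (*-identityˡ (f zero)) (∑-zero (λ a → zeroˡ (f (suc a))))) (+-identityʳ _)
  ∑-Iˡ (suc k) f = trans (cong₂ _+_ (zeroˡ (f zero)) (∑-Iˡ k (f ∘ suc))) (+-identityˡ _)

  ∑-Iʳ : ∀ {n} (k : Fin n) (f : Fin n → Carrier) → ∑ F (λ a → f a * I F a k) ≡ f k
  ∑-Iʳ zero f = trans (cong₂ _+_ (*-identityʳ (f zero)) (∑-zero (λ a → zeroʳ (f (suc a))))) (+-identityʳ _)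
  ∑-Iʳ (suc k) f = trans (cong₂ _+_ (zeroʳ (f zero)) (∑-Iʳ k (f ∘ suc))) (+-identityˡ _)

  infixl 7 _·_
  _·_ : ∀ {n} → Matrix F n → Matrix F n → Matrix F n
  _·_ = _⊗_ F

  diag : ∀ {n} → (Fin n → Carrier) → Matrix F n
  diag d i j = d i * I F i j

  diag-by-column : ∀ {n} (d : Fin n → Carrier) i j → d i * I F i j ≡ d j * I F i j
  diag-by-column d i j with i Fin.≟ j
  ... | yes refl = refl
  ... | no i≢j   = begin
    d i * I F i j  ≡⟨ cong (d i *_) (I-off i≢j) ⟩
    d i * 0#       ≡⟨ zeroʳ (d i) ⟩
    0#             ≡⟨ zeroʳ (d j) ⟨
    d j * 0#       ≡⟨ cong (d j *_) (I-off i≢j) ⟨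
    d j * I F i j  ∎

  diag-· : ∀ {n} (d : Fin n → Carrier) (M : Matrix F n) i j → (diag d · M) i j ≡ d i * M i j
  diag-· d M i j = begin
    ∑ F (λ k → (d i * I F i k) * M k j)  ≡⟨ ∑-cong (λ k → xy∙z≈y∙xz (d i) (I F i k) (M k j)) ⟩
    ∑ F (λ k → I F i k * (d i * M k j))  ≡⟨ ∑-Iˡ i (λ k → d i * M k j) ⟩
    d i * M i j                          ∎

  diag-·-diag : ∀ {n} (d e : Fin n → Carrier) → (∀ i → d i * e i ≡ 1#) →
                ∀ i j → (diag d · diag e) i j ≡ I F i j
  diag-·-diag d e de≡1 i j = begin
    (diag d · diag e) i j  ≡⟨ diag-· d (diag e) i j ⟩
    d i * (e i * I F i j)  ≡⟨ *-assoc (d i) (e i) (I F i j) ⟨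
    (d i * e i) * I F i j  ≡⟨ cong (_* I F i j) (de≡1 i) ⟩
    1# * I F i j           ≡⟨ *-identityˡ _ ⟩
    I F i j                ∎

  *-∑≡1⇒≡0 : ∀ {n} x (v w : Fin n → Carrier) →
             ∑ F (λ a → v a * w a) ≡ 1# → (∀ a → x * v a ≡ 0#) → x ≡ 0#
  *-∑≡1⇒≡0 x v w ∑vw≡1 xv≡0 = begin
    x                                ≡⟨ *-identityʳ x ⟨
    x * 1#                           ≡⟨ cong (x *_) ∑vw≡1 ⟨
    x * ∑ F (λ a → v a * w a)        ≡⟨ *-distribˡ-∑ x (λ a → v a * w a) ⟩
    ∑ F (λ a → x * (v a * w a))      ≡⟨ ∑-zero xvw≡0 ⟩
    0#                               ∎
    where
    xvw≡0 : ∀ a → x * (v a * w a) ≡ 0#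
    xvw≡0 a = trans (sym (*-assoc x (v a) (w a))) (trans (cong (_* w a) (xv≡0 a)) (zeroˡ (w a)))

  module _ {r' : ℕ} where
    private
      n : ℕ
      n = ℕ.suc (ℕ.suc r')

    last : Fin n
    last = fromℕ (ℕ.suc r')

    elation : Carrier → Matrix F n
    elation = elationMatrix F n

    elation-off-row : ∀ l {i} j → ¬ i ≡ last → elation l i j ≡ I F i j
    elation-off-row l {i} j i≢last =
      cong (λ b → if b ∧ does (toℕ j ℕ.≟ 0) then l else I F i j)
           (dec-false (toℕ i ℕ.≟ ℕ.suc r') (λ e → i≢last (toℕ-injective (trans e (sym (toℕ-fromℕ _))))))

    elation-off-column : ∀ l i j → elation l i (suc j) ≡ I F i (suc j)
    elation-off-column l i j =
      cong (λ b → if b then l else I F i (suc j)) (∧-zeroʳ (does (toℕ i ℕ.≟ ℕ.suc r')))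

    elation-corner : ∀ l → elation l last zero ≡ l
    elation-corner l =
      cong (λ b → if b ∧ true then l else I F last zero) (dec-true (toℕ last ℕ.≟ ℕ.suc r') (toℕ-fromℕ _))

    elation-entry : ∀ l i j → elation l i j ≡ I F i j + (l * I F i last) * I F zero j
    elation-entry l i j with i Fin.≟ last
    elation-entry l i j | no i≢last = begin
      elation l i j                              ≡⟨ elation-off-row l j i≢last ⟩
      I F i j                                    ≡⟨ +-identityʳ _ ⟨
      I F i j + 0#                               ≡⟨ cong (I F i j +_) (zeroˡ _) ⟨
      I F i j + 0# * I F zero j                  ≡⟨ cong (λ t → I F i j + t * I F zero j) (zeroʳ l) ⟨
      I F i j + (l * 0#) * I F zero j            ≡⟨ cong (λ t → I F i j + (l * t) * I F zero j) (I-off i≢last) ⟨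
      I F i j + (l * I F i last) * I F zero j    ∎
    elation-entry l .last zero | yes refl = begin
      elation l last zero                        ≡⟨ elation-corner l ⟩
      l                                          ≡⟨ *-identityʳ l ⟨
      l * 1#                                     ≡⟨ cong (l *_) (I-diag last) ⟨
      l * I F last last                          ≡⟨ *-identityʳ _ ⟨
      (l * I F last last) * 1#                   ≡⟨ +-identityˡ _ ⟨
      0# + (l * I F last last) * 1#              ∎
    elation-entry l .last (suc j) | yes refl = begin
      elation l last (suc j)                     ≡⟨ elation-off-column l last j ⟩
      I F last (suc j)                           ≡⟨ +-identityʳ _ ⟨
      I F last (suc j) + 0#                      ≡⟨ cong (I F last (suc j) +_) (zeroʳ _) ⟨
      I F last (suc j) + (l * I F last last) * 0# ∎

    ·-elation : ∀ (M : Matrix F n) l i k →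
      (M · elation l) i k ≡ M i k + (l * M i last) * I F zero k
    ·-elation M l i k = begin
      ∑ F (λ a → M i a * elation l a k)
        ≡⟨ ∑-cong (λ a → trans (cong (M i a *_) (elation-entry l a k)) (distribˡ _ _ _)) ⟩
      ∑ F (λ a → M i a * I F a k + M i a * ((l * I F a last) * I F zero k))
        ≡⟨ ∑-distrib-+ (λ a → M i a * I F a k) (λ a → M i a * ((l * I F a last) * I F zero k)) ⟩
      ∑ F (λ a → M i a * I F a k) + ∑ F (λ a → M i a * ((l * I F a last) * I F zero k))
        ≡⟨ cong (∑ F (λ a → M i a * I F a k) +_) (∑-cong regroup) ⟩
      ∑ F (λ a → M i a * I F a k) + ∑ F (λ a → ((l * M i a) * I F zero k) * I F a last)
        ≡⟨ cong₂ _+_ (∑-Iʳ k (M i)) (∑-Iʳ last (λ a → (l * M i a) * I F zero k)) ⟩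
      M i k + (l * M i last) * I F zero k ∎
      where
      regroup : ∀ a → M i a * ((l * I F a last) * I F zero k) ≡ ((l * M i a) * I F zero k) * I F a last
      regroup a = begin
        M i a * ((l * I F a last) * I F zero k)  ≡⟨ *-assoc (M i a) (l * I F a last) (I F zero k) ⟨
        (M i a * (l * I F a last)) * I F zero k  ≡⟨ cong (_* I F zero k) (x∙yz≈yx∙z (M i a) l (I F a last)) ⟩
        ((l * M i a) * I F a last) * I F zero k  ≡⟨ xy∙z≈xz∙y (l * M i a) (I F a last) (I F zero k) ⟩
        ((l * M i a) * I F zero k) * I F a last  ∎

    conjugate-elation : ∀ (M N : Matrix F n) l i j →
      ((M · elation l) · N) i j ≡ (M · N) i j + (l * M i last) * N zero j
    conjugate-elation M N l i j = begin
      ∑ F (λ k → (M · elation l) i k * N k j)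
        ≡⟨ ∑-cong (λ k → trans (cong (_* N k j) (·-elation M l i k)) (distribʳ _ _ _)) ⟩
      ∑ F (λ k → M i k * N k j + ((l * M i last) * I F zero k) * N k j)
        ≡⟨ ∑-distrib-+ (λ k → M i k * N k j) (λ k → ((l * M i last) * I F zero k) * N k j) ⟩
      (M · N) i j + ∑ F (λ k → ((l * M i last) * I F zero k) * N k j)
        ≡⟨ cong ((M · N) i j +_) (∑-cong (λ k → xy∙z≈y∙xz (l * M i last) (I F zero k) (N k j))) ⟩
      (M · N) i j + ∑ F (λ k → I F zero k * ((l * M i last) * N k j))
        ≡⟨ cong ((M · N) i j +_) (∑-Iˡ zero (λ k → (l * M i last) * N k j)) ⟩
      (M · N) i j + (l * M i last) * N zero j ∎

    -- A rank-one matrix has vanishing 2 × 2 minors, so the (0,0) and (1,1)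
    -- equations force (u₀v₀)² = (u₀v₁)(u₁v₀) = 0.
    rank-one-update≡elation : ∀ (u v : Fin n → Carrier) {c m} →
      (∀ i j → I F i j + u i * v j ≡ c * elation m i j) → c ≡ 1# × m ≡ u last * v zero
    rank-one-update≡elation u v {c} {m} eq = c≡1 , m≡u₁v₀
      where
      one : Fin n
      one = suc zero

      1+u₀v₀≡c : 1# + u zero * v zero ≡ c
      1+u₀v₀≡c = trans (eq zero zero) (*-identityʳ c)

      1+u₁v₁≡c : 1# + u one * v one ≡ c
      1+u₁v₁≡c = trans (eq one one) (trans (cong (c *_) (elation-off-column m one zero)) (*-identityʳ c))

      u₀v₁≡0 : u zero * v one ≡ 0#
      u₀v₁≡0 = trans (sym (+-identityˡ _)) (trans (eq zero one) (zeroʳ c))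

      u₀v₀≡u₁v₁ : u zero * v zero ≡ u one * v one
      u₀v₀≡u₁v₁ = +-cancelˡ 1# _ _ (trans 1+u₀v₀≡c (sym 1+u₁v₁≡c))

      u₀v₀²≡0 : (u zero * v zero) * (u zero * v zero) ≡ 0#
      u₀v₀²≡0 = begin
        (u zero * v zero) * (u zero * v zero) ≡⟨ cong ((u zero * v zero) *_) u₀v₀≡u₁v₁ ⟩
        (u zero * v zero) * (u one * v one)   ≡⟨ cong ((u zero * v zero) *_) (*-comm (u one) (v one)) ⟩
        (u zero * v zero) * (v one * u one)   ≡⟨ *-interchange (u zero) (v zero) (v one) (u one) ⟩
        (u zero * v one) * (v zero * u one)   ≡⟨ cong ((u zero * v one) *_) (*-comm (v zero) (u one)) ⟩
        (u zero * v one) * (u one * v zero)   ≡⟨ cong (_* (u one * v zero)) u₀v₁≡0 ⟩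
        0# * (u one * v zero)                 ≡⟨ zeroˡ _ ⟩
        0#                                    ∎

      u₀v₀≡0 : u zero * v zero ≡ 0#
      u₀v₀≡0 with x*y≡0⇒x≡0⊎y≡0 u₀v₀²≡0
      ... | inj₁ u₀v₀≡0 = u₀v₀≡0
      ... | inj₂ u₀v₀≡0 = u₀v₀≡0

      c≡1 : c ≡ 1#
      c≡1 = trans (sym 1+u₀v₀≡c) (trans (cong (1# +_) u₀v₀≡0) (+-identityʳ 1#))

      m≡u₁v₀ : m ≡ u last * v zero
      m≡u₁v₀ = begin
        m                         ≡⟨ *-identityˡ m ⟨
        1# * m                    ≡⟨ cong₂ _*_ c≡1 (elation-corner m) ⟨
        c * elation m last zero   ≡⟨ eq last zero ⟨
        0# + u last * v zero      ≡⟨ +-identityˡ _ ⟩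
        u last * v zero           ∎

    module Conjugation (g g' : Matrix F n) (gg'≡I : ∀ i j → (g · g') i j ≡ I F i j) where

      α : Carrier
      α = g last last * g' zero zero

      conjugate-elation-entry : ∀ l i j →
        ((g · elation l) · g') i j ≡ I F i j + (l * g i last) * g' zero j
      conjugate-elation-entry l i j =
        trans (conjugate-elation g g' l i j) (cong (_+ (l * g i last) * g' zero j) (gg'≡I i j))

      conjugate≡c*elation⇒c≡1×m≡αl : ∀ {l m c} →
        (∀ i j → ((g · elation l) · g') i j ≡ c * elation m i j) → c ≡ 1# × m ≡ α * l
      conjugate≡c*elation⇒c≡1×m≡αl {l} eq
        with rank-one-update≡elation (λ i → l * g i last) (g' zero)
               (λ i j → trans (sym (conjugate-elation-entry l i j)) (eq i j))
      ... | c≡1 , m≡lg₁₁g'₀₀ = c≡1 , trans m≡lg₁₁g'₀₀ (xy∙z≈yz∙x l (g last last) (g' zero zero))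

      α≡0⇒l≡0×m≡0 : (∀ i j → (g' · g) i j ≡ I F i j) → α ≡ 0# → ∀ {l m c} →
        (∀ i j → ((g · elation l) · g') i j ≡ c * elation m i j) → l ≡ 0# × m ≡ 0#
      α≡0⇒l≡0×m≡0 g'g≡I α≡0 {l} {m} {c} eq = l≡0 , m≡0
        where
        c≡1×m≡αl : c ≡ 1# × m ≡ α * l
        c≡1×m≡αl = conjugate≡c*elation⇒c≡1×m≡αl eq

        m≡0 : m ≡ 0#
        m≡0 = trans (proj₂ c≡1×m≡αl) (trans (cong (_* l) α≡0) (zeroˡ l))

        update≡0 : ∀ i j → (l * g i last) * g' zero j ≡ 0#
        update≡0 i j = +-cancelˡ (I F i j) _ _ (begin
          I F i j + (l * g i last) * g' zero j      ≡⟨ conjugate-elation-entry l i j ⟨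
          ((g · elation l) · g') i j                ≡⟨ eq i j ⟩
          c * elation m i j                         ≡⟨ cong₂ (λ c m → c * elation m i j) (proj₁ c≡1×m≡αl) m≡0 ⟩
          1# * elation 0# i j                       ≡⟨ *-identityˡ _ ⟩
          elation 0# i j                            ≡⟨ elation-entry 0# i j ⟩
          I F i j + (0# * I F i last) * I F zero j  ≡⟨ cong (I F i j +_) (trans (cong (_* I F zero j) (zeroˡ _)) (zeroˡ _)) ⟩
          I F i j + 0#                              ∎)

        -- The unit entries (g' · g)₀₀ and (g' · g)_{last,last} show that the first
        -- row of g' and the last column of g cannot annihilate l.
        l*g-last≡0 : ∀ k → l * g k last ≡ 0#
        l*g-last≡0 k = *-∑≡1⇒≡0 (l * g k last) (g' zero) (λ a → g a zero) (g'g≡I zero zero) (update≡0 k)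

        l≡0 : l ≡ 0#
        l≡0 = *-∑≡1⇒≡0 l (λ a → g a last) (g' last)
                (trans (∑-cong (λ a → *-comm (g a last) (g' last a))) (trans (g'g≡I last last) (I-diag last)))
                l*g-last≡0

    conjugate⇒equivalent : ∀ E E' → Conjugate F n E E' → Equivalent F E E'
    conjugate⇒equivalent E E' (g , g' , gg'≡I , g'g≡I , fwd , bwd) = equivalence (α ≟ 0#)
      where
      open Conjugation g g' gg'≡I

      equivalence : Dec (α ≡ 0#) → Equivalent F E E'
      equivalence (no α≢0) = α , α≢0 , λ x → to x , from x
        where
        to : ∀ x → H E' x → Σ Carrier (λ y → H E y × x ≡ α * y)
        to x x∈H' with bwd x x∈H'
        ... | y , y∈H , _ , _ , eq = y , y∈H , proj₂ (conjugate≡c*elation⇒c≡1×m≡αl eq)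
        from : ∀ x → Σ Carrier (λ y → H E y × x ≡ α * y) → H E' x
        from x (y , y∈H , x≡αy) with fwd y y∈H
        ... | m , m∈H' , _ , _ , eq =
          subst (H E') (trans (proj₂ (conjugate≡c*elation⇒c≡1×m≡αl eq)) (sym x≡αy)) m∈H'
      equivalence (yes α≡0) = 1# , 1≢0 , λ x → to x , from x
        where
        to : ∀ x → H E' x → Σ Carrier (λ y → H E y × x ≡ 1# * y)
        to x x∈H' with bwd x x∈H'
        ... | _ , _ , _ , _ , eq = 0# , H-0 E , trans (proj₂ (α≡0⇒l≡0×m≡0 g'g≡I α≡0 eq)) (sym (zeroʳ 1#))
        from : ∀ x → Σ Carrier (λ y → H E y × x ≡ 1# * y) → H E' x
        from x (y , y∈H , x≡1y) with fwd y y∈H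
        ... | _ , _ , _ , _ , eq = subst (H E') (sym x≡0) (H-0 E')
          where
          x≡0 : x ≡ 0#
          x≡0 = trans x≡1y (trans (cong (1# *_) (proj₁ (α≡0⇒l≡0×m≡0 g'g≡I α≡0 eq))) (zeroʳ 1#))

    scaleFirst : Carrier → Fin n → Carrier
    scaleFirst a zero    = a
    scaleFirst a (suc _) = 1#

    scaleFirst-inverse : ∀ {a b} → a * b ≡ 1# → ∀ i → scaleFirst a i * scaleFirst b i ≡ 1#
    scaleFirst-inverse ab≡1 zero    = ab≡1
    scaleFirst-inverse ab≡1 (suc i) = *-identityˡ 1#

    scaleFirst-conjugates-elation : ∀ {α β} → β * α ≡ 1# → ∀ l i j →
      ((diag (scaleFirst β) · elation l) · diag (scaleFirst α)) i j ≡ elation (α * l) i j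
    scaleFirst-conjugates-elation {α} {β} βα≡1 l i j = begin
      ((diag (scaleFirst β) · elation l) · diag (scaleFirst α)) i j
        ≡⟨ conjugate-elation (diag (scaleFirst β)) (diag (scaleFirst α)) l i j ⟩
      (diag (scaleFirst β) · diag (scaleFirst α)) i j
        + (l * (scaleFirst β i * I F i last)) * (α * I F zero j)
        ≡⟨ cong₂ _+_ (diag-·-diag _ _ (scaleFirst-inverse βα≡1) i j)
                     (cong (λ t → (l * t) * (α * I F zero j))
                           (trans (diag-by-column (scaleFirst β) i last) (*-identityˡ _))) ⟩
      I F i j + (l * I F i last) * (α * I F zero j)
        ≡⟨ cong (I F i j +_) (trans (*-interchange l (I F i last) α (I F zero j))
             (trans (cong (_* (I F i last * I F zero j)) (*-comm l α)) (sym (*-assoc (α * l) (I F i last) (I F zero j))))) ⟩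
      I F i j + ((α * l) * I F i last) * I F zero j
        ≡⟨ elation-entry (α * l) i j ⟨
      elation (α * l) i j ∎

    equivalent⇒conjugate : ∀ E E' → Equivalent F E E' → Conjugate F n E E'
    equivalent⇒conjugate E E' (α , α≢0 , H'≡αH) with inverse α α≢0
    ... | β , αβ≡1 =
      diag (scaleFirst β) , diag (scaleFirst α) ,
      diag-·-diag _ _ (scaleFirst-inverse βα≡1) , diag-·-diag _ _ (scaleFirst-inverse αβ≡1) ,
      to , from
      where
      βα≡1 : β * α ≡ 1#
      βα≡1 = trans (*-comm β α) αβ≡1

      conjugate : Carrier → Matrix F n
      conjugate l = (diag (scaleFirst β) · elation l) · diag (scaleFirst α)

      conj : ∀ l → _∼_ F (conjugate l) (elation (α * l))
      conj l = 1# , 1≢0 , λ i j → trans (scaleFirst-conjugates-elation βα≡1 l i j) (sym (*-identityˡ _))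

      to : ∀ l → H E l → Σ Carrier λ m → H E' m × _∼_ F (conjugate l) (elation m)
      to l l∈H = α * l , proj₂ (H'≡αH (α * l)) (l , l∈H , refl) , conj l

      from : ∀ m → H E' m → Σ Carrier λ l → H E l × _∼_ F (conjugate l) (elation m)
      from m m∈H' with proj₁ (H'≡αH m) m∈H'
      ... | l , l∈H , refl = l , l∈H , conj l

lemma1 : (p h : ℕ) → Prime p → 1 ≤ h → (F : GF p h) →
    (r : ℕ) → 2 ≤ r → (E E' : ElationGroup F) →
    (Conjugate F r E E' → Equivalent F E E') ×
    (Equivalent F E E' → Conjugate F r E E')
lemma1 _ _ _ _ F (ℕ.suc (ℕ.suc r')) (s≤s (s≤s z≤n)) E E' =
  conjugate⇒equivalent F E E' , equivalent⇒conjugate F E E'
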